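{- Let $d\geq1$, $k\geq1$, let $\mathbf p=(p_1,\dots,p_k)$ be a vector of polynomials in $\mathbb Z[i_1,\dots,i_d,n]$ of total degree at most one, let $\mathbf m=(m_1,\dots,m_k)$ be positive integers, and let $R=\prod_{q=1}^k\{0,\dots,m_q-1\}$. For each $\mathbf r\in R$ let $\mathbf S_{\mathbf r}\subseteq\mathbb Z^d$ be finite, and let $\mathbf i_0\in\mathbb Z^d$. Consider (unrestricted) walks in $\mathbb Z^d$ starting at $\mathbf i_0$ in which, whenever the walk is at position $\mathbf i$ after $n$ steps, the next step is taken from $\mathbf S_{\mathbf r}$ with $\mathbf r=\mathbf p(\mathbf i,n)\bmod\mathbf m$ (componentwise). Let $\mathbf S$ be the disjoint union of the sets $\mathbf S_{\mathbf r}$, $\mathbf r\in R$, so that each such walk is a word over the alphabet $\mathbf S$ (each step being recorded as an element of the copy of $\mathbf S_{\mathbf r}$ it was taken from); a vector $(a_{\mathbf u})_{\mathbf u\in\mathbf S}$ of nonnegative integers is said to be associated with the walk if $a_{\mathbf u}$ is the number of occurrences of $\mathbf u$ in this word. For $\mathbf r,\mathbf s\in R$ let $\mathbf S_{\mathbf r}^{\mathbf s}$ be the set of steps $\mathbf u\in\mathbf S_{\mathbf r}$ (in its copy in $\mathbf S$) such that $\mathbf p(\mathbf i+\mathbf u,n+1)=\mathbf s\bmod\mathbf m$ whenever $\mathbf p(\mathbf i,n)=\mathbf r\bmod\mathbf m$ (this does not depend on $(\mathbf i,n)$). Let $(a_{\mathbf u})_{\mathbf u\in\mathbf S}$ be a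 vector of nonnegative integers and let $G$ be the directed multigraph with vertex set $R$ having $\sum_{\mathbf u\in\mathbf S_{\mathbf r}^{\mathbf s}}a_{\mathbf u}$ edges from $\mathbf r$ to $\mathbf s$ for all $\mathbf r,\mathbf s\in R$. Then $(a_{\mathbf u})_{\mathbf u\in\mathbf S}$ is associated with some such walk starting at $\mathbf i_0$ if and only if $G$ has an Eulerian path (a directed path using every edge exactly once) starting at a vertex $\mathbf r_0$ with $\mathbf p(\mathbf i_0,0)=\mathbf r_0\bmod\mathbf m$. -}

module Defs where

open import Data.Nat as ℕ using (ℕ; suc; _<_)
open import Data.Integer as ℤ using (ℤ; +_; _-_)
open import Data.Integer.Divisibility using (_∣_)
open import Data.Fin using (Fin)
open import Data.Vec using (Vec; lookup; zipWith; foldr)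
import Data.Vec.Properties as VecP
import Data.Product.Properties as ProdP
open import Data.Product using (_×_; Σ; _,_)
open import Data.List using (List; []; _∷_; length; filter)
open import Data.List.Membership.Propositional using (_∈_)
open import Data.Unit using (⊤)
open import Relation.Binary.PropositionalEquality using (_≡_)
open import Relation.Binary.Definitions using (DecidableEquality)

Pt : ℕ → Set
Pt d = Vec ℤ d

Res : ℕ → Set
Res k = Vec ℕ k

_⊕_ : ∀ {d} → Pt d → Pt d → Pt d
_⊕_ = zipWith ℤ._+_

dot : ∀ {d} → Vec ℤ d → Vec ℤ d → ℤ
dot u v = foldr _ ℤ._+_ (+ 0) (zipWith ℤ._*_ u v)

-- A vector p = (p_1,…,p_k) of polynomials in ℤ[i_1,…,i_d,n] of total
-- degree ≤ 1:  p_q(i,n) = Σ_j lin q j * i_j + ncoef q * n + const q.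
record LinPolys (d k : ℕ) : Set where
  constructor linPolys
  field
    lin   : Fin k → Vec ℤ d
    ncoef : Fin k → ℤ
    const : Fin k → ℤ

eval : ∀ {d k} → LinPolys d k → Fin k → Pt d → ℕ → ℤ
eval P q i n = dot (LinPolys.lin P q) i ℤ.+ (LinPolys.ncoef P q ℤ.* (+ n)) ℤ.+ LinPolys.const P q

InR : ∀ {k} → (Fin k → ℕ) → Res k → Set
InR m r = ∀ q → lookup r q < m q

PCong : ∀ {d k} → LinPolys d k → (Fin k → ℕ) → Pt d → ℕ → Res k → Set
PCong P m i n r = ∀ q → (+ (m q)) ∣ (eval P q i n - (+ lookup r q))

-- Letters of the alphabet S = ⊔_{r∈R} S_r : pairs (r , u) with u ∈ S_r.
Letter : ℕ → ℕ → Set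
Letter d k = Res k × Pt d

letter-≟ : ∀ {d k} → DecidableEquality (Letter d k)
letter-≟ = ProdP.≡-dec (VecP.≡-dec ℕ._≟_) (VecP.≡-dec ℤ._≟_)

occ : ∀ {d k} → Letter d k → List (Letter d k) → ℕ
occ x w = length (filter (letter-≟ x) w)

IsWalk : ∀ {d k} → LinPolys d k → (Fin k → ℕ) → (Res k → List (Pt d)) →
         Pt d → ℕ → List (Letter d k) → Set
IsWalk P m S i n [] = ⊤
IsWalk P m S i n ((r , u) ∷ w) =
  InR m r × u ∈ S r × PCong P m i n r × IsWalk P m S (i ⊕ u) (suc n) w

Associated : ∀ {d k} → (Fin k → ℕ) → (Res k → List (Pt d)) →
             (Res k → Pt d → ℕ) → List (Letter d k) → Set
Associated {d} {k} m S a w =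
  (r : Res k) (u : Pt d) → InR m r → u ∈ S r → occ (r , u) w ≡ a r u

InSrs : ∀ {d k} → LinPolys d k → (Fin k → ℕ) → Res k → Res k → Pt d → Set
InSrs {d} P m r s u =
  (i : Pt d) (n : ℕ) → PCong P m i n r → PCong P m (i ⊕ u) (suc n) s

-- The multigraph G: vertex set R; its edges are the triples (r , u , j) with
-- r ∈ R, u ∈ S_r and j < a_u (the a_u copies contributed by u); the edge
-- (r , u , j) goes from r to the unique s with u ∈ S_r^s.  Thus there are
-- Σ_{u ∈ S_r^s} a_u edges from r to s.
Edge : ℕ → ℕ → Set
Edge d k = Res k × Pt d × ℕ

IsEdge : ∀ {d k} → (Fin k → ℕ) → (Res k → List (Pt d)) →
         (Res k → Pt d → ℕ) → Edge d k → Set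
IsEdge m S a (r , u , j) = InR m r × u ∈ S r × j < a r u

IsPathFrom : ∀ {d k} → LinPolys d k → (Fin k → ℕ) → Res k → List (Edge d k) → Set
IsPathFrom P m v [] = ⊤
IsPathFrom {d} {k} P m v ((r , u , j) ∷ es) =
  r ≡ v × Σ (Res k) (λ s → InR m s × InSrs P m r s u × IsPathFrom P m s es)

module Submission where

-- A walk w from i₀ and an Eulerian path of G from the class r₀ of (i₀ , 0)
-- are two readings of the same object.
--
-- Since p has degree at most one, a step u changes p_q by an
-- amount depending on u alone (eval-step).  Hence one witness suffices for
-- u ∈ S_r^s (transition-witness), and every position has exactly one residue
-- class in R (residue-exists, residue-unique).
--
-- Letters and edges differ only by the copy index j, and
-- along both a walk and a path the current class is forced by the position;
-- so an edge list is a path from the class of (i , n) iff its word of letters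
-- is a walk from (i , n) (walk⇒path, path⇒walk).
--
-- A word w is turned into an edge list by labelling the
-- occurrences of each letter x by 0, …, occ x w - 1 (label); conversely, if a
-- duplicate-free edge list contains exactly the copies j < c of x, then x
-- occurs c times in its word (occ-copies).

open import Defs
open import Data.Nat as ℕ using (ℕ; suc; _<_; _≤_)
import Data.Nat.Properties as ℕP
import Data.Nat.Divisibility as ℕD
open import Data.Nat.DivMod using (m<n⇒m%n≡m)
open import Data.Integer as ℤ using (ℤ; +_; _-_; _+_; _*_)
import Data.Integer.Properties as ℤP
open import Data.Integer.Divisibility.Signed
  using (_∣_; ∣ᵤ⇒∣; ∣⇒∣ᵤ; ∣m∣n⇒∣m+n; ∣m∣n⇒∣m-n; ∣n⇒∣m*n; ∣-refl)
open import Data.Integer.DivMod using (_%ℕ_; _/ℕ_; a≡a%ℕn+[a/ℕn]*n; n%ℕd<d)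
open import Data.Integer.Tactic.RingSolver using (solve-∀)
open import Data.Fin using (Fin)
open import Data.Vec using (Vec; []; _∷_; lookup; tabulate)
open import Data.Vec.Properties using (lookup∘tabulate; tabulate∘lookup; tabulate-cong)
open import Data.Product using (Σ; _×_; _,_; proj₁; proj₂)
open import Data.List using (List; []; _∷_; length; filter; map; applyUpTo)
open import Data.List.Properties using (filter-accept; filter-reject; length-map; length-applyUpTo)
open import Data.List.Membership.Propositional using (_∈_)
open import Data.List.Membership.Propositional.Properties
  using (∈-map⁺; ∈-filter⁺; ∈-filter⁻; ∈-applyUpTo⁺; ∈-applyUpTo⁻)
open import Data.List.Membership.Propositional.Properties.WithK using (unique∧set⇒bag)
open import Data.List.Relation.Binary.BagAndSetEquality using (_∼[_]_; set; ∼bag⇒↭)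
open import Data.List.Relation.Binary.Permutation.Propositional.Properties using (↭-length)
open import Data.List.Relation.Unary.Any using (here; there)
import Data.List.Relation.Unary.All as All
open import Data.List.Relation.Unary.AllPairs using ([]; _∷_)
open import Data.List.Relation.Unary.Unique.Propositional using (Unique)
open import Data.List.Relation.Unary.Unique.Propositional.Properties using (filter⁺; applyUpTo⁺₁)
open import Data.Unit using (tt)
open import Data.Bool using (true; false)
open import Data.Sum using (inj₁; inj₂)
open import Relation.Nullary using (Dec; yes; no; ¬_; does)
open import Relation.Unary using (Pred; Decidable)
open import Relation.Binary.PropositionalEquality
open import Function using (_∘_)
open import Function.Bundles using (_⇔_; mk⇔)

dot-⊕ : ∀ {d} (l i u : Vec ℤ d) → dot l (i ⊕ u) ≡ dot l i + dot l u
dot-⊕ []      []      []      = refl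
dot-⊕ (x ∷ l) (a ∷ i) (b ∷ u) rewrite dot-⊕ l i u = ring x a b (dot l i) (dot l u)
  where
  ring : ∀ x a b D E → x * (a + b) + (D + E) ≡ (x * a + D) + (x * b + E)
  ring = solve-∀

increment : ∀ {d k} → LinPolys d k → Fin k → Pt d → ℤ
increment P q u = dot (LinPolys.lin P q) u + LinPolys.ncoef P q

eval-step : ∀ {d k} (P : LinPolys d k) (q : Fin k) (i u : Pt d) (n : ℕ) →
            eval P q (i ⊕ u) (suc n) ≡ eval P q i n + increment P q u
eval-step P q i u n rewrite dot-⊕ (LinPolys.lin P q) i u =
  ring (dot l i) (dot l u) (LinPolys.ncoef P q) (+ n) (LinPolys.const P q)
  where
  l = LinPolys.lin P q
  ring : ∀ Li Lu c N K → Li + Lu + c * (+ 1 + N) + K ≡ Li + c * N + K + (Lu + c)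
  ring = solve-∀

shift-congruence : ∀ {m} e f r s δ → m ∣ e - r → m ∣ f - r → m ∣ e + δ - s → m ∣ f + δ - s
shift-congruence {m} e f r s δ e≡r f≡r e+δ≡s =
  subst (m ∣_) (ring e f r s δ) (∣m∣n⇒∣m+n f≡r (∣m∣n⇒∣m-n e+δ≡s e≡r))
  where
  ring : ∀ e f r s δ → (f - r) + ((e + δ - s) - (e - r)) ≡ f + δ - s
  ring = solve-∀

-- PCong read with signed divisibility, which has the better algebra.
signed : ∀ {d k} (P : LinPolys d k) (m : Fin k → ℕ) (i : Pt d) (n : ℕ) (r : Res k) →
         PCong P m i n r → ∀ q → + m q ∣ eval P q i n - + lookup r q
signed P m i n r i≡r q = ∣ᵤ⇒∣ (i≡r q)

transition-witness : ∀ {d k} (P : LinPolys d k) (m : Fin k → ℕ) {r s : Res k} {u i : Pt d} {n : ℕ} →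
                     PCong P m i n r → PCong P m (i ⊕ u) (suc n) s → InSrs P m r s u
transition-witness P m {r} {s} {u} {i} {n} i≡r i+u≡s i′ n′ i′≡r q =
  ∣⇒∣ᵤ (subst (λ x → + m q ∣ x - + lookup s q) (sym (eval-step P q i′ u n′))
         (shift-congruence (eval P q i n) (eval P q i′ n′) (+ lookup r q) (+ lookup s q) (increment P q u)
           (signed P m i n r i≡r q) (signed P m i′ n′ r i′≡r q)
           (subst (λ x → + m q ∣ x - + lookup s q) (eval-step P q i u n) (signed P m (i ⊕ u) (suc n) s i+u≡s q))))

multiple-below-modulus : ∀ {m x} → m ℕD.∣ x → x < m → x ≡ 0
multiple-below-modulus {suc m} {x} m∣x x<m =
  trans (sym (m<n⇒m%n≡m x<m)) (ℕD.n∣m⇒m%n≡0 x (suc m) m∣x)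

digit-unique : ∀ {m a b} → a < m → b < m → + m ∣ + a - + b → a ≡ b
digit-unique {m} {a} {b} a<m b<m m∣a-b =
  ℤP.+-injective (ℤP.i-j≡0⇒i≡j (+ a) (+ b) (ℤP.∣i∣≡0⇒i≡0 ∣a-b∣≡0))
  where
  ∣a-b∣<m : ℤ.∣ + a - + b ∣ < m
  ∣a-b∣<m = subst (λ z → ℤ.∣ z ∣ < m) (sym (ℤP.[+m]-[+n]≡m⊖n a b))
              (ℕP.≤-<-trans (ℤP.∣m⊝n∣≤m⊔n a b) (ℕP.⊔-lub a<m b<m))
  ∣a-b∣≡0 : ℤ.∣ + a - + b ∣ ≡ 0
  ∣a-b∣≡0 = multiple-below-modulus (∣⇒∣ᵤ m∣a-b) ∣a-b∣<m

residue-unique : ∀ {d k} (P : LinPolys d k) (m : Fin k → ℕ) {i : Pt d} {n : ℕ} {r v : Res k} →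
                 InR m r → InR m v → PCong P m i n r → PCong P m i n v → r ≡ v
residue-unique P m {i} {n} {r} {v} r∈R v∈R i≡r i≡v = begin
  r                     ≡⟨ sym (tabulate∘lookup r) ⟩
  tabulate (lookup r)   ≡⟨ tabulate-cong same-digit ⟩
  tabulate (lookup v)   ≡⟨ tabulate∘lookup v ⟩
  v                     ∎
  where
  open ≡-Reasoning
  ring : ∀ e a b → (e - b) - (e - a) ≡ a - b
  ring = solve-∀
  same-digit : ∀ q → lookup r q ≡ lookup v q
  same-digit q = digit-unique {m q} {lookup r q} {lookup v q} (r∈R q) (v∈R q)
    (subst (+ m q ∣_) (ring (eval P q i n) (+ lookup r q) (+ lookup v q))
      (∣m∣n⇒∣m-n (signed P m i n v i≡v q) (signed P m i n r i≡r q)))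

residue-exists : ∀ {d k} (P : LinPolys d k) (m : Fin k → ℕ) → (∀ q → 0 < m q) →
                 (i : Pt d) (n : ℕ) → Σ (Res k) λ r → InR m r × PCong P m i n r
residue-exists {k = k} P m m>0 i n = tabulate digit , digit<m , i≡digit
  where
  digit : Fin k → ℕ
  digit q = _%ℕ_ (eval P q i n) (m q) {{ℕ.>-nonZero (m>0 q)}}
  digit<m : InR m (tabulate digit)
  digit<m q rewrite lookup∘tabulate digit q = n%ℕd<d (eval P q i n) (m q) {{ℕ.>-nonZero (m>0 q)}}
  ring : ∀ a b → a + b - a ≡ b
  ring = solve-∀
  i≡digit : PCong P m i n (tabulate digit)
  i≡digit q rewrite lookup∘tabulate digit q =
    ∣⇒∣ᵤ (subst (+ m q ∣_) (sym e-digit≡quot*m) (∣n⇒∣m*n quot ∣-refl))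
    where
    e = eval P q i n
    quot = _/ℕ_ e (m q) {{ℕ.>-nonZero (m>0 q)}}
    e-digit≡quot*m : e - + digit q ≡ quot * + m q
    e-digit≡quot*m = trans (cong (_- + digit q) (a≡a%ℕn+[a/ℕn]*n e (m q) {{ℕ.>-nonZero (m>0 q)}}))
                           (ring (+ digit q) (quot * + m q))

copy : ∀ {d k} → Letter d k → ℕ → Edge d k
copy (r , u) j = r , u , j

letterOf : ∀ {d k} → Edge d k → Letter d k
letterOf (r , u , _) = r , u

filter-map : ∀ {A B : Set} {p} {Q : Pred B p} (Q? : Decidable Q) (f : A → B) (xs : List A) →
             filter Q? (map f xs) ≡ map f (filter (Q? ∘ f) xs)
filter-map Q? f []       = refl
filter-map Q? f (x ∷ xs) with does (Q? (f x))
... | true  = cong (f x ∷_) (filter-map Q? f xs)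
... | false = filter-map Q? f xs

module _ {d k : ℕ} where

  occ-here : (x : Letter d k) (w : List (Letter d k)) → occ x (x ∷ w) ≡ suc (occ x w)
  occ-here x w = cong length (filter-accept (letter-≟ x) refl)

  occ-there : {x y : Letter d k} (w : List (Letter d k)) → ¬ x ≡ y → occ x (y ∷ w) ≡ occ x w
  occ-there {x} w x≢y = cong length (filter-reject (letter-≟ x) x≢y)

  occ-≤-cons : (x y : Letter d k) (w : List (Letter d k)) → occ x w ≤ occ x (y ∷ w)
  occ-≤-cons x y w = by-cases (letter-≟ x y)
    where
    by-cases : Dec (x ≡ y) → occ x w ≤ occ x (y ∷ w)
    by-cases (yes refl) = subst (occ x w ≤_) (sym (occ-here x w)) (ℕP.n≤1+n _)
    by-cases (no x≢y)   = ℕP.≤-reflexive (sym (occ-there w x≢y))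

  -- The edge list of a word: an occurrence of x is labelled by the number of
  -- occurrences of x after it, so the occurrences of x receive the labels
  -- 0, …, occ x w - 1, each once.
  label : List (Letter d k) → List (Edge d k)
  label []      = []
  label (x ∷ w) = copy x (occ x w) ∷ label w

  letters-label : (w : List (Letter d k)) → map letterOf (label w) ≡ w
  letters-label []            = refl
  letters-label ((r , u) ∷ w) = cong ((r , u) ∷_) (letters-label w)

  label-∈⁻ : ∀ {r u j} (w : List (Letter d k)) → (r , u , j) ∈ label w → j < occ (r , u) w
  label-∈⁻ ((r , u) ∷ w) (here refl) = subst (occ (r , u) w <_) (sym (occ-here (r , u) w)) ℕP.≤-refl
  label-∈⁻ (x ∷ w)       (there e∈)  = ℕP.<-≤-trans (label-∈⁻ w e∈) (occ-≤-cons _ x w)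

  label-∈⁺ : ∀ {r u j} (w : List (Letter d k)) → j < occ (r , u) w → (r , u , j) ∈ label w
  label-∈⁺ []      ()
  label-∈⁺ {r} {u} {j} (x ∷ w) j<occ = by-cases (letter-≟ (r , u) x)
    where
    by-cases : Dec ((r , u) ≡ x) → (r , u , j) ∈ label (x ∷ w)
    by-cases (no x≢y)   = there (label-∈⁺ w (subst (j <_) (occ-there w x≢y) j<occ))
    by-cases (yes refl) with ℕP.m<1+n⇒m<n∨m≡n (subst (j <_) (occ-here (r , u) w) j<occ)
    ... | inj₁ j<occ′ = there (label-∈⁺ w j<occ′)
    ... | inj₂ refl   = here refl

  label-unique : (w : List (Letter d k)) → Unique (label w)
  label-unique []            = []
  label-unique ((r , u) ∷ w) =
    All.tabulate (λ e∈ e≡ → ℕP.<-irrefl refl (label-∈⁻ w (subst (_∈ label w) (sym e≡) e∈)))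
    ∷ label-unique w

  occ-copies : (r : Res k) (u : Pt d) (c : ℕ) (es : List (Edge d k)) → Unique es →
               (∀ {j} → (r , u , j) ∈ es → j < c) → (∀ {j} → j < c → (r , u , j) ∈ es) →
               occ (r , u) (map letterOf es) ≡ c
  occ-copies r u c es es-unique sound complete = begin
    occ (r , u) (map letterOf es)   ≡⟨ cong length (filter-map (letter-≟ (r , u)) letterOf es) ⟩
    length (map letterOf edges)     ≡⟨ length-map letterOf edges ⟩
    length edges                    ≡⟨ ↭-length (∼bag⇒↭ (unique∧set⇒bag edges-unique copies-unique same-edges)) ⟩
    length copies                   ≡⟨ length-applyUpTo (copy (r , u)) c ⟩
    c                               ∎
    where
    open ≡-Reasoning
    edges   = filter (letter-≟ (r , u) ∘ letterOf) es
    copies  = applyUpTo (copy (r , u)) c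
    edges-unique : Unique edges
    edges-unique = filter⁺ (letter-≟ (r , u) ∘ letterOf) es-unique
    copies-unique : Unique copies
    copies-unique = applyUpTo⁺₁ (copy (r , u)) c
                      (λ i<j _ i≡j → ℕP.<-irrefl (cong (proj₂ ∘ proj₂) i≡j) i<j)
    edge⇒copy : ∀ {e} → e ∈ edges → e ∈ copies
    edge⇒copy {r′ , u′ , j} e∈ with ∈-filter⁻ (letter-≟ (r , u) ∘ letterOf) e∈
    ... | e∈es , refl = ∈-applyUpTo⁺ (copy (r , u)) (sound e∈es)
    copy⇒edge : ∀ {e} → e ∈ copies → e ∈ edges
    copy⇒edge e∈ with ∈-applyUpTo⁻ (copy (r , u)) e∈
    ... | j , j<c , refl = ∈-filter⁺ (letter-≟ (r , u) ∘ letterOf) (complete j<c) refl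
    same-edges : edges ∼[ set ] copies
    same-edges = mk⇔ edge⇒copy copy⇒edge

module _ {d k : ℕ} (P : LinPolys d k) (m : Fin k → ℕ) (S : Res k → List (Pt d)) where

  walk-letters : ∀ {i n r u} (w : List (Letter d k)) → IsWalk P m S i n w →
                 (r , u) ∈ w → InR m r × u ∈ S r
  walk-letters (_ ∷ w) (r∈R , u∈S , _)    (here refl) = r∈R , u∈S
  walk-letters (_ ∷ w) (_ , _ , _ , walk) (there x∈)  = walk-letters w walk x∈

  walk⇒path : (∀ q → 0 < m q) → ∀ {i n v} (es : List (Edge d k)) →
              IsWalk P m S i n (map letterOf es) → InR m v → PCong P m i n v → IsPathFrom P m v es
  walk⇒path m>0 []                _                                 _   _   = tt
  walk⇒path m>0 {i} {n} ((r , u , j) ∷ es) (r∈R , _ , i≡r , walk) v∈R i≡v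
    with residue-exists P m m>0 (i ⊕ u) (suc n)
  ... | s , s∈R , i+u≡s =
    residue-unique P m {i} {n} r∈R v∈R i≡r i≡v , s , s∈R ,
    transition-witness P m {r} {s} {u} {i} {n} i≡r i+u≡s ,
    walk⇒path m>0 es walk s∈R i+u≡s

  path⇒walk : ∀ {i n v} (es : List (Edge d k)) → IsPathFrom P m v es → PCong P m i n v →
              (∀ {r u j} → (r , u , j) ∈ es → InR m r × u ∈ S r) → IsWalk P m S i n (map letterOf es)
  path⇒walk []                _                            _   _     = tt
  path⇒walk {i} {n} ((r , u , j) ∷ es) (refl , s , _ , u∈Srs , path) i≡r legal =
    proj₁ (legal (here refl)) , proj₂ (legal (here refl)) , i≡r ,
    path⇒walk es path (u∈Srs i n i≡r) (legal ∘ there)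

  WalkWith : Pt d → (Res k → Pt d → ℕ) → Set
  WalkWith i₀ a = Σ (List (Letter d k)) λ w → IsWalk P m S i₀ 0 w × Associated m S a w

  EulerianPathFrom : (Res k → Pt d → ℕ) → Res k → List (Edge d k) → Set
  EulerianPathFrom a r₀ es =
    Unique es × (∀ e → e ∈ es → IsEdge m S a e) × (∀ e → IsEdge m S a e → e ∈ es) × IsPathFrom P m r₀ es

  EulerianPath : Pt d → (Res k → Pt d → ℕ) → Set
  EulerianPath i₀ a = Σ (Res k) λ r₀ → InR m r₀ × PCong P m i₀ 0 r₀ ×
                      Σ (List (Edge d k)) (EulerianPathFrom a r₀)

  walk⇒eulerian : (∀ q → 0 < m q) → (i₀ : Pt d) (a : Res k → Pt d → ℕ) → WalkWith i₀ a → EulerianPath i₀ a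
  walk⇒eulerian m>0 i₀ a (w , walk , assoc) with residue-exists P m m>0 i₀ 0
  ... | r₀ , r₀∈R , i₀≡r₀ =
    r₀ , r₀∈R , i₀≡r₀ , label w , label-unique w , sound , complete ,
    walk⇒path m>0 (label w) walk′ r₀∈R i₀≡r₀
    where
    walk′ : IsWalk P m S i₀ 0 (map letterOf (label w))
    walk′ = subst (IsWalk P m S i₀ 0) (sym (letters-label w)) walk
    sound : ∀ e → e ∈ label w → IsEdge m S a e
    sound (r , u , j) e∈ with walk-letters w walk (subst (_ ∈_) (letters-label w) (∈-map⁺ letterOf e∈))
    ... | r∈R , u∈S = r∈R , u∈S , subst (j <_) (assoc r u r∈R u∈S) (label-∈⁻ w e∈)
    complete : ∀ e → IsEdge m S a e → e ∈ label w
    complete (r , u , j) (r∈R , u∈S , j<a) = label-∈⁺ w (subst (j <_) (sym (assoc r u r∈R u∈S)) j<a)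

  eulerian⇒walk : (i₀ : Pt d) (a : Res k → Pt d → ℕ) → EulerianPath i₀ a → WalkWith i₀ a
  eulerian⇒walk i₀ a (r₀ , _ , i₀≡r₀ , es , es-unique , sound , complete , path) =
    map letterOf es , path⇒walk es path i₀≡r₀ legal , assoc
    where
    legal : ∀ {r u j} → (r , u , j) ∈ es → InR m r × u ∈ S r
    legal e∈ with sound _ e∈
    ... | r∈R , u∈S , _ = r∈R , u∈S
    assoc : Associated m S a (map letterOf es)
    assoc r u r∈R u∈S = occ-copies r u (a r u) es es-unique
      (λ e∈ → proj₂ (proj₂ (sound _ e∈))) (λ j<a → complete _ (r∈R , u∈S , j<a))

lemma4 : (d k : ℕ) → 1 ≤ d → 1 ≤ k →
         (P : LinPolys d k) (m : Fin k → ℕ) → (∀ q → 0 < m q) →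
         (S : Res k → List (Pt d)) → (∀ r → InR m r → Unique (S r)) →
         (i₀ : Pt d) (a : Res k → Pt d → ℕ) →
         (Σ (List (Letter d k)) (λ w → IsWalk P m S i₀ 0 w × Associated m S a w))
         ⇔
         (Σ (Res k) (λ r₀ → InR m r₀ × PCong P m i₀ 0 r₀ ×
            Σ (List (Edge d k)) (λ es →
              Unique es × (∀ e → e ∈ es → IsEdge m S a e) ×
              (∀ e → IsEdge m S a e → e ∈ es) × IsPathFrom P m r₀ es)))
lemma4 d k _ _ P m m>0 S _ i₀ a =
  mk⇔ (walk⇒eulerian P m S m>0 i₀ a) (eulerian⇒walk P m S i₀ a)
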